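{- Let $p$ be a prime number and let $R$ be a subset of the residues modulo $p$ with $|R|=s$. Let $L=\{l\in\{0,1,2,\dots\} : l \bmod p \in R\}$. Then for every graph $G$: (i) $\displaystyle \operatorname{mr}_p(G^c)\leq \sum_{t=0}^{s}\binom{\Theta_L(G)}{t}$; (ii) $\displaystyle \operatorname{mr}_p(G)\leq \sum_{t=0}^{p-1}\binom{\Theta_L(G)}{t}$.
   Context: All graphs are finite and simple; $G^c$ denotes the complement of $G$. For a set $L$ of non-negative integers, an $L$-intersection representation of a graph $G=(V,E)$ assigns to each vertex $v$ a finite set $A_v$ such that for distinct $u,v$, $u$ and $v$ are adjacent if and only if $|A_u\cap A_v|\in L$. The $L$-intersection number $\Theta_L(G)$ is the minimum of $|\bigcup_{v\in V}A_v|$ over all $L$-intersection representations of $G$. For a field $\mathbb{F}$ and a symmetric $n\times n$ matrix $A$ over $\mathbb{F}$, the graph $\mathcal{G}(A)$ has vertex set $\{1,\dots,n\}$ and edges $\{ij: i\neq j,\ A_{ij}\neq 0\}$ (diagonal entries are ignored). The minimum rank of an $n$-vertex graph $G$ over $\mathbb{F}$ is $\operatorname{mr}^{\mathbb{F}}(G)=\min\{\operatorname{rank}(A): A \text{ symmetric } n\times n \text{ over } \mathbb{F},\ \mathcal{G}(A)=G\}$; $\operatorname{mr}_p(G)$ denotes $\operatorname{mr}^{\mathbb{Z}_p}(G)$. -}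

module Defs where

open import Data.Nat using (ℕ; zero; suc; _+_; _*_; _∸_; _≤_; NonZero)
open import Data.Nat.DivMod using (_%_; _mod_)
open import Data.Nat.Combinatorics using (_C_)
open import Data.Bool using (Bool; true; false; not; if_then_else_)
open import Data.Fin using (Fin; toℕ; _≟_)
open import Data.Fin.Subset using (Subset; _∈_; _∩_; ∣_∣; ⋃)
open import Data.List using (List; map; upTo; allFin)
open import Data.Nat.ListAction using (sum)
open import Data.Product using (Σ; _×_; _,_)
open import Relation.Nullary using (¬_; does; yes; no)
open import Relation.Binary.PropositionalEquality using (_≡_; _≢_; refl; sym)
open import Data.Empty using (⊥-elim)
open import Function.Bundles using (_⇔_)

record Graph (n : ℕ) : Set where
  field
    adj     : Fin n → Fin n → Bool
    adj-sym : ∀ i j → adj i j ≡ adj j i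
    adj-irr : ∀ i → adj i i ≡ false
open Graph public

Edge : ∀ {n} → Graph n → Fin n → Fin n → Set
Edge G i j = adj G i j ≡ true

compAdj : ∀ {n} → Graph n → Fin n → Fin n → Bool
compAdj G i j with i ≟ j
... | yes _ = false
... | no  _ = not (adj G i j)

compAdj-sym : ∀ {n} (G : Graph n) i j → compAdj G i j ≡ compAdj G j i
compAdj-sym G i j with i ≟ j | j ≟ i
... | yes _ | yes _ = refl
... | yes i≡j | no j≢i = ⊥-elim (j≢i (sym i≡j))
... | no i≢j | yes j≡i = ⊥-elim (i≢j (sym j≡i))
... | no _ | no _ rewrite adj-sym G i j = refl

compAdj-irr : ∀ {n} (G : Graph n) i → compAdj G i i ≡ false
compAdj-irr G i with i ≟ i
... | yes _ = refl
... | no i≢i = ⊥-elim (i≢i refl)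

complement : ∀ {n} → Graph n → Graph n
complement G = record { adj = compAdj G ; adj-sym = compAdj-sym G ; adj-irr = compAdj-irr G }

sumFin : (k : ℕ) → (Fin k → ℕ) → ℕ
sumFin zero    f = 0
sumFin (suc k) f = f Fin.zero + sumFin k (λ j → f (Fin.suc j))

module _ (p : ℕ) .{{_ : NonZero p}} where

  Mat : ℕ → Set
  Mat n = Fin n → Fin n → Fin p

  Symmetric : ∀ {n} → Mat n → Set
  Symmetric A = ∀ i j → A i j ≡ A j i

  GraphOf≡ : ∀ {n} → Mat n → Graph n → Set
  GraphOf≡ A G = ∀ i j → i ≢ j → (Edge G i j ⇔ (toℕ (A i j) ≢ 0))

  IndependentCols : ∀ {n k} → Mat n → (Fin k → Fin n) → Set
  IndependentCols {n} {k} A cols =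
    (a : Fin k → Fin p) →
    (∀ i → sumFin k (λ j → toℕ (a j) * toℕ (A i (cols j))) % p ≡ 0) →
    ∀ j → toℕ (a j) ≡ 0

  HasRank : ∀ {n} → Mat n → ℕ → Set
  HasRank {n} A r =
    Σ (Fin r → Fin n) (λ cols → IndependentCols A cols) ×
    (∀ k (cols : Fin k → Fin n) → IndependentCols A cols → k ≤ r)

  IsMinRank : ∀ {n} → Graph n → ℕ → Set
  IsMinRank {n} G m =
    Σ (Mat n) (λ A → Symmetric A × GraphOf≡ A G × HasRank A m) ×
    (∀ (A : Mat n) → Symmetric A → GraphOf≡ A G → ∀ r → HasRank A r → m ≤ r)

  InL : Subset p → ℕ → Set
  InL R l = (l mod p) ∈ R

-- L-intersection representation of G with all sets inside the ground set Fin k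
-- (any finite family of finite sets can be relabelled into some Fin k).
IsLRep : ∀ {n k} → (ℕ → Set) → Graph n → (Fin n → Subset k) → Set
IsLRep L G A = ∀ i j → i ≢ j → (Edge G i j ⇔ L ∣ A i ∩ A j ∣)

unionSize : ∀ {n k} → (Fin n → Subset k) → ℕ
unionSize {n} A = ∣ ⋃ (map A (allFin n)) ∣

IsTheta : ∀ {n} → (ℕ → Set) → Graph n → ℕ → Set
IsTheta {n} L G m =
  Σ ℕ (λ k → Σ (Fin n → Subset k) (λ A → IsLRep L G A × unionSize A ≡ m)) ×
  (∀ k (A : Fin n → Subset k) → IsLRep L G A → m ≤ unionSize A)

binomSum : ℕ → ℕ → ℕ
binomSum m s = sum (map (m C_) (upTo (suc s)))

module Submission where

-- Take an optimal L-representation u ↦ A u with union U, |U| = θ, and put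
-- M u v = F |A u ∩ A v| (mod p).  For F y = ∏_{r ∈ R} (y - r) the entry
-- vanishes exactly on the edges of G, so M is a pattern matrix for G^c; for
-- F y = ∏_{r ∉ R} (y - r) it is one for G.  These F have degree |R|, resp.
-- at most p - 1, in the finite-difference sense modulo p.  The key lemma
-- (factorise) writes F |α ∩ β| = ⟨φ α, ψ β⟩ (mod p) for α, β ⊆ U with vectors
-- of length Σ_{t ≤ s} C(|U|,t), by induction on U using F(y+1) = F(y) + ΔF(y).
-- Gaussian elimination (dependence) bounds independent column families of
-- such a product by the inner dimension, which bounds the rank of M and
-- hence the minimum rank.

open import Defs
open import Data.Nat using (ℕ; zero; suc; _+_; _*_; _∸_; _≤_; _<_; NonZero; z≤n; s≤s; s≤s⁻¹)
open import Data.Nat.Properties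
open import Data.Nat.DivMod using (_%_; _mod_; %-distribˡ-+; %-distribˡ-*; m%n%n≡m%n; m*n%n≡0; [m+n]%n≡m%n; %-remove-+ˡ; m<n⇒m%n≡m; n%n≡0)
open import Data.Nat.Divisibility using (_∣_; _∣?_; _∣0; ∣-trans; ∣1⇒≡1; ∣m∣n⇒∣m+n; n∣m*n; m∣m*n; m%n≡0⇒n∣m; n∣m⇒m%n≡0)
open import Data.Nat.Primality using (Prime; euclidsLemma; prime⇒nonTrivial)
open import Data.Nat.Base using (nonTrivial⇒≢1; >-nonZero⁻¹)
open import Data.Nat.Combinatorics using (_C_; nCk+nC[k+1]≡[n+1]C[k+1])
open import Data.Nat.ListAction using (sum)
open import Data.Nat.Tactic.RingSolver using (solve-∀)
open import Data.Bool using (Bool; true; false; not; _∧_; if_then_else_)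
open import Data.Fin using (Fin; toℕ; punchIn; _↑ˡ_; _↑ʳ_; finToFun; funToFin) renaming (_≟_ to _≟ᶠ_)
open import Data.Fin.Properties using (any?; all?; toℕ-fromℕ<; toℕ-injective; toℕ<n; finToFun-funToFin)
open import Data.Fin.Subset using (Subset; inside; outside; _∈_; _⊆_; _∩_; ∣_∣; ⋃; ∁; ⊤)
open import Data.Fin.Subset.Properties using (drop-∷-⊆; ⊆-trans; p⊆p∪q; q⊆p∪q; ∩-comm; ∣∁p∣≡n∸∣p∣; ∣p∣≡n⇒p≡⊤; ∈⊤; x∈p⇒x∉∁p; x∉∁p⇒x∈p)
open import Data.Vec using ([]; _∷_; head; tail; here; there)
open import Data.Vec.Functional using (_++_; insertAt)
open import Data.Vec.Functional.Properties using (lookup-++ˡ; lookup-++ʳ; insertAt-lookup; insertAt-punchIn)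
open import Data.List using (List; map; allFin; applyUpTo)
import Data.List as List
import Data.List.Relation.Unary.Any as Any
open import Data.List.Membership.Propositional using () renaming (_∈_ to _∈ₗ_)
open import Data.List.Membership.Propositional.Properties using (∈-map⁺; ∈-allFin)
open import Data.Product using (Σ; ∃; _×_; _,_)
open import Data.Sum using (inj₁; inj₂)
open import Data.Empty using (⊥-elim)
open import Relation.Nullary using (¬_; Dec; yes; no; ¬?)
open import Relation.Nullary.Decidable using (map′; _→-dec_; decidable-stable)
open import Relation.Binary.PropositionalEquality
open import Function using (_∘_)
open import Function.Bundles using (_⇔_; mk⇔; Equivalence)
open import Function.Properties.Equivalence using () renaming (trans to ⇔-trans; sym to ⇔-sym)
open import Function.Related.TypeIsomorphisms using (¬-cong-⇔)

open Equivalence using (to; from)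

dot : ∀ {D} → (Fin D → ℕ) → (Fin D → ℕ) → ℕ
dot {D} f g = sumFin D (λ d → f d * g d)

sumFin-cong : ∀ k {f g : Fin k → ℕ} → (∀ i → f i ≡ g i) → sumFin k f ≡ sumFin k g
sumFin-cong zero    f≗g = refl
sumFin-cong (suc k) f≗g = cong₂ _+_ (f≗g Fin.zero) (sumFin-cong k (f≗g ∘ Fin.suc))

sumFin-zero : ∀ k {f : Fin k → ℕ} → (∀ i → f i ≡ 0) → sumFin k f ≡ 0
sumFin-zero zero    f≗0 = refl
sumFin-zero (suc k) f≗0 = cong₂ _+_ (f≗0 Fin.zero) (sumFin-zero k (f≗0 ∘ Fin.suc))

sumFin-+ : ∀ k (f g : Fin k → ℕ) → sumFin k (λ i → f i + g i) ≡ sumFin k f + sumFin k g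
sumFin-+ zero    f g = refl
sumFin-+ (suc k) f g =
  trans (cong (f Fin.zero + g Fin.zero +_) (sumFin-+ k (f ∘ Fin.suc) (g ∘ Fin.suc)))
        (interchange (f Fin.zero) (g Fin.zero) _ _)
  where
  interchange : ∀ a b c d → a + b + (c + d) ≡ a + c + (b + d)
  interchange = solve-∀

sumFin-scale : ∀ k c (f : Fin k → ℕ) → c * sumFin k f ≡ sumFin k (λ i → c * f i)
sumFin-scale zero    c f = *-zeroʳ c
sumFin-scale (suc k) c f =
  trans (*-distribˡ-+ c (f Fin.zero) _) (cong (c * f Fin.zero +_) (sumFin-scale k c (f ∘ Fin.suc)))

sumFin-swap : ∀ k D (h : Fin k → Fin D → ℕ) →
  sumFin k (λ j → sumFin D (h j)) ≡ sumFin D (λ d → sumFin k (λ j → h j d))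
sumFin-swap zero    D h = sym (sumFin-zero D (λ _ → refl))
sumFin-swap (suc k) D h =
  trans (cong (sumFin D (h Fin.zero) +_) (sumFin-swap k D (h ∘ Fin.suc)))
        (sym (sumFin-+ D (h Fin.zero) _))

sumFin-∣ : ∀ {p} k {f : Fin k → ℕ} → (∀ i → p ∣ f i) → p ∣ sumFin k f
sumFin-∣ {p} zero    p∣f = p ∣0
sumFin-∣     (suc k) p∣f = ∣m∣n⇒∣m+n (p∣f Fin.zero) (sumFin-∣ k (p∣f ∘ Fin.suc))

sumFin-punchIn : ∀ k (m : Fin (suc k)) (f : Fin (suc k) → ℕ) →
  sumFin (suc k) f ≡ f m + sumFin k (f ∘ punchIn m)
sumFin-punchIn k       Fin.zero    f = refl
sumFin-punchIn (suc k) (Fin.suc m) f =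
  trans (cong (f Fin.zero +_) (sumFin-punchIn k m (f ∘ Fin.suc)))
        (left-comm (f Fin.zero) (f (Fin.suc m)) _)
  where
  left-comm : ∀ a b c → a + (b + c) ≡ b + (a + c)
  left-comm = solve-∀

sumFin-split : ∀ m {n} (h : Fin (m + n) → ℕ) →
  sumFin (m + n) h ≡ sumFin m (λ i → h (i ↑ˡ n)) + sumFin n (λ i → h (m ↑ʳ i))
sumFin-split zero    h = refl
sumFin-split (suc m) h =
  trans (cong (h Fin.zero +_) (sumFin-split m (h ∘ Fin.suc))) (sym (+-assoc (h Fin.zero) _ _))

dot-++ : ∀ {m n} (f f' : Fin m → ℕ) (g g' : Fin n → ℕ) →
  dot (f ++ g) (f' ++ g') ≡ dot f f' + dot g g'
dot-++ {m} {n} f f' g g' =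
  trans (sumFin-split m _)
        (cong₂ _+_ (sumFin-cong m (λ i → cong₂ _*_ (lookup-++ˡ f g i) (lookup-++ˡ f' g' i)))
                   (sumFin-cong n (λ i → cong₂ _*_ (lookup-++ʳ f g i) (lookup-++ʳ f' g' i))))

sumFin-insertAt : ∀ k (f : Fin k → ℕ) m y (w : Fin (suc k) → ℕ) →
  sumFin (suc k) (λ x → insertAt f m y x * w x) ≡ y * w m + sumFin k (λ j → f j * w (punchIn m j))
sumFin-insertAt k f m y w =
  trans (sumFin-punchIn k m (λ x → insertAt f m y x * w x))
        (cong₂ _+_ (cong (_* w m) (insertAt-lookup f m y))
                   (sumFin-cong k (λ j → cong (_* w (punchIn m j)) (insertAt-punchIn f m y j))))

sumFin-dot : ∀ k {D} (a : Fin k → ℕ) (b : Fin D → ℕ) (c : Fin k → Fin D → ℕ) →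
  sumFin k (λ j → a j * dot b (c j)) ≡ dot b (λ d → sumFin k (λ j → a j * c j d))
sumFin-dot k {D} a b c = begin
  sumFin k (λ j → a j * dot b (c j))
    ≡⟨ sumFin-cong k (λ j → trans (sumFin-scale D (a j) _)
                                  (sumFin-cong D (λ d → left-comm (a j) (b d) (c j d)))) ⟩
  sumFin k (λ j → sumFin D (λ d → b d * (a j * c j d)))
    ≡⟨ sumFin-swap k D _ ⟩
  sumFin D (λ d → sumFin k (λ j → b d * (a j * c j d)))
    ≡⟨ sumFin-cong D (λ d → sym (sumFin-scale k (b d) _)) ⟩
  dot b (λ d → sumFin k (λ j → a j * c j d)) ∎
  where
  open ≡-Reasoning
  left-comm : ∀ x y z → x * (y * z) ≡ y * (x * z)
  left-comm = solve-∀

⊆-⋃ : ∀ {k} {xs : List (Subset k)} {x} → x ∈ₗ xs → x ⊆ ⋃ xs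
⊆-⋃                 (Any.here refl) = p⊆p∪q _
⊆-⋃ {xs = y List.∷ ys} (Any.there x∈ys) = ⊆-trans (⊆-⋃ x∈ys) (q⊆p∪q y (⋃ ys))

prodOver : ∀ {m} → Subset m → (Fin m → ℕ) → ℕ
prodOver []            g = 1
prodOver (inside  ∷ R) g = g Fin.zero * prodOver R (g ∘ Fin.suc)
prodOver (outside ∷ R) g = prodOver R (g ∘ Fin.suc)

module Congruence (p : ℕ) .{{_ : NonZero p}} where

  infix 4 _≈_
  _≈_ : ℕ → ℕ → Set
  x ≈ y = x % p ≡ y % p

  ≡⇒≈ : ∀ {x y} → x ≡ y → x ≈ y
  ≡⇒≈ = cong (_% p)

  +-≈ : ∀ {a a' b b'} → a ≈ a' → b ≈ b' → a + b ≈ a' + b'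
  +-≈ {a} {a'} {b} {b'} a≈a' b≈b' =
    trans (%-distribˡ-+ a b p) (trans (cong₂ (λ x y → (x + y) % p) a≈a' b≈b') (sym (%-distribˡ-+ a' b' p)))

  *-≈ : ∀ {a a' b b'} → a ≈ a' → b ≈ b' → a * b ≈ a' * b'
  *-≈ {a} {a'} {b} {b'} a≈a' b≈b' =
    trans (%-distribˡ-* a b p) (trans (cong₂ (λ x y → (x * y) % p) a≈a' b≈b') (sym (%-distribˡ-* a' b' p)))

  %-≈ : ∀ x → x % p ≈ x
  %-≈ x = m%n%n≡m%n x p

  0%p : 0 % p ≡ 0
  0%p = m*n%n≡0 0 p

  ≈0⇒∣ : ∀ {x} → x ≈ 0 → p ∣ x
  ≈0⇒∣ {x} x≈0 = m%n≡0⇒n∣m x p (trans x≈0 0%p)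

  ∣⇒≈0 : ∀ {x} → p ∣ x → x ≈ 0
  ∣⇒≈0 {x} p∣x = trans (n∣m⇒m%n≡0 x p p∣x) (sym 0%p)

  -- p ∸ 1 plays the role of -1.
  minus-one : ∀ x → x + (p ∸ 1) * x ≈ 0
  minus-one x = trans (≡⇒≈ x+[p-1]x≡px) (trans (≡⇒≈ (*-comm p x)) (trans (m*n%n≡0 x p) (sym 0%p)))
    where
    x+[p-1]x≡px : x + (p ∸ 1) * x ≡ p * x
    x+[p-1]x≡px = cong (_* x) (m+[n∸m]≡n {1} {p} (>-nonZero⁻¹ p))

  sumFin-≈ : ∀ k {f g : Fin k → ℕ} → (∀ i → f i ≈ g i) → sumFin k f ≈ sumFin k g
  sumFin-≈ zero    f≈g = refl
  sumFin-≈ (suc k) f≈g = +-≈ (f≈g Fin.zero) (sumFin-≈ k (f≈g ∘ Fin.suc))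

  toℕ-mod : ∀ y → toℕ (y mod p) ≡ y % p
  toℕ-mod y = toℕ-fromℕ< _

  p∣⇔residue≡0 : ∀ x → p ∣ x ⇔ toℕ (x mod p) ≡ 0
  p∣⇔residue≡0 x = mk⇔ (λ p∣x → trans (toℕ-mod x) (n∣m⇒m%n≡0 x p p∣x))
                       (λ x≡0 → m%n≡0⇒n∣m x p (trans (sym (toℕ-mod x)) x≡0))

  -- y - r for a residue r, written with naturals as y + (p - r).
  shift : ℕ → Fin p → ℕ
  shift y r = y + (p ∸ toℕ r)

  rootProduct : Subset p → ℕ → ℕ
  rootProduct R y = prodOver R (shift y)

  p∣shift⇔ : ∀ y r → p ∣ shift y r ⇔ y mod p ≡ r
  p∣shift⇔ y r = mk⇔ ⇒ ⇐
    where
    r≤p : toℕ r ≤ p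
    r≤p = <⇒≤ (toℕ<n r)

    ⇒ : p ∣ shift y r → y mod p ≡ r
    ⇒ p∣y-r = toℕ-injective (begin
      toℕ (y mod p)                   ≡⟨ toℕ-mod y ⟩
      y % p                           ≡⟨ [m+n]%n≡m%n y p ⟨
      (y + p) % p                     ≡⟨ cong (λ z → (y + z) % p) (m∸n+n≡m r≤p) ⟨
      (y + ((p ∸ toℕ r) + toℕ r)) % p ≡⟨ cong (_% p) (+-assoc y _ (toℕ r)) ⟨
      (shift y r + toℕ r) % p         ≡⟨ %-remove-+ˡ (toℕ r) p∣y-r ⟩
      toℕ r % p                       ≡⟨ m<n⇒m%n≡m (toℕ<n r) ⟩
      toℕ r                           ∎)
      where open ≡-Reasoning

    ⇐ : y mod p ≡ r → p ∣ shift y r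
    ⇐ refl = ≈0⇒∣ (begin
      (y + (p ∸ t)) % p   ≡⟨ +-≈ y≈t refl ⟩
      (t + (p ∸ t)) % p   ≡⟨ cong (_% p) (m+[n∸m]≡n (<⇒≤ (toℕ<n (y mod p)))) ⟩
      p % p               ≡⟨ trans (n%n≡0 p) (sym 0%p) ⟩
      0 % p               ∎)
      where
      open ≡-Reasoning
      t = toℕ (y mod p)
      y≈t : y ≈ t
      y≈t = trans (sym (%-≈ y)) (≡⇒≈ (sym (toℕ-mod y)))

-- Degree modulo p of functions ℕ → ℕ, defined by finite differences.
module Degree (p : ℕ) .{{_ : NonZero p}} where
  open Congruence p

  -- Forward difference ΔF(y) = F(y+1) - F(y) modulo p.
  Δ : (ℕ → ℕ) → ℕ → ℕ
  Δ F y = F (suc y) + (p ∸ 1) * F y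

  HasDegree : ℕ → (ℕ → ℕ) → Set
  HasDegree zero    F = ∀ y → F y ≈ F 0
  HasDegree (suc s) F = HasDegree s (Δ F)

  Δ-step : ∀ F y → F (suc y) ≈ F y + Δ F y
  Δ-step F y = sym (begin
    (F y + (F (suc y) + q * F y)) % p ≡⟨ cong (_% p) (rearrange (F y) (F (suc y)) q) ⟩
    (F (suc y) + (F y + q * F y)) % p ≡⟨ +-≈ {F (suc y)} refl (minus-one (F y)) ⟩
    (F (suc y) + 0) % p               ≡⟨ cong (_% p) (+-identityʳ (F (suc y))) ⟩
    F (suc y) % p                     ∎)
    where
    open ≡-Reasoning
    q = p ∸ 1
    rearrange : ∀ a b q → a + (b + q * a) ≡ b + (a + q * a)
    rearrange = solve-∀

  Δ-cong : ∀ {F G} → (∀ y → F y ≈ G y) → ∀ y → Δ F y ≈ Δ G y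
  Δ-cong F≈G y = +-≈ (F≈G (suc y)) (*-≈ {p ∸ 1} refl (F≈G y))

  Δ-constant : ∀ {F} → HasDegree zero F → ∀ y → Δ F y ≈ 0
  Δ-constant {F} F≈F0 y = trans (+-≈ (F≈F0 (suc y)) (*-≈ {p ∸ 1} refl (F≈F0 y))) (minus-one (F 0))

  deg-cong : ∀ s {F G} → (∀ y → F y ≈ G y) → HasDegree s F → HasDegree s G
  deg-cong zero    F≈G deg y = trans (sym (F≈G y)) (trans (deg y) (F≈G 0))
  deg-cong (suc s) F≈G deg = deg-cong s (Δ-cong F≈G) deg

  deg-+ : ∀ s {F G} → HasDegree s F → HasDegree s G → HasDegree s (λ y → F y + G y)
  deg-+ zero    degF degG y = +-≈ (degF y) (degG y)
  deg-+ (suc s) {F} {G} degF degG =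
    deg-cong s (λ y → ≡⇒≈ (Δ-+ (F (suc y)) (G (suc y)) (F y) (G y) (p ∸ 1))) (deg-+ s degF degG)
    where
    Δ-+ : ∀ a b c d q → a + q * c + (b + q * d) ≡ a + b + q * (c + d)
    Δ-+ = solve-∀

  deg-shift : ∀ s {F} → HasDegree s F → HasDegree s (F ∘ suc)
  deg-shift zero    deg y = trans (deg (suc y)) (sym (deg 1))
  deg-shift (suc s) deg = deg-shift s deg

  deg-suc : ∀ s {F} → HasDegree s F → HasDegree (suc s) F
  deg-suc zero    deg y = trans (Δ-constant deg y) (sym (Δ-constant deg 0))
  deg-suc (suc s) deg = deg-suc s deg

  deg-≤ : ∀ {s t F} → s ≤ t → HasDegree s F → HasDegree t F
  deg-≤ {zero}  {zero}  z≤n       deg = deg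
  deg-≤ {zero}  {suc t} z≤n       deg = deg-suc t (deg-≤ {zero} {t} z≤n deg)
  deg-≤ {suc s} {suc t} (s≤s s≤t) deg = deg-≤ {s} {t} s≤t deg

  -- Multiplying by a linear factor y + c raises the degree by one,
  -- since Δ((y+c)F)(y) = (y+c)·ΔF(y) + F(y+1).
  deg-linear : ∀ s c {F} → HasDegree s F → HasDegree (suc s) (λ y → (y + c) * F y)
  deg-linear s c {F} deg =
    deg-cong s (λ y → ≡⇒≈ (sym (Δ-linear y c (F (suc y)) (F y) (p ∸ 1))))
               (deg-+ s (scaled-Δ s deg) (deg-shift s deg))
    where
    Δ-linear : ∀ y c a b q → (suc y + c) * a + q * ((y + c) * b) ≡ (y + c) * (a + q * b) + a
    Δ-linear = solve-∀

    scaled-Δ : ∀ s {F} → HasDegree s F → HasDegree s (λ y → (y + c) * Δ F y)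
    scaled-Δ zero {F} deg y = trans (vanishes y) (sym (vanishes 0))
      where
      vanishes : ∀ y → (y + c) * Δ F y ≈ 0
      vanishes y = trans (*-≈ {y + c} refl (Δ-constant deg y)) (≡⇒≈ (*-zeroʳ (y + c)))
    scaled-Δ (suc s) deg = deg-linear s c deg

  deg-prodOver : ∀ {m} (R : Subset m) (c : Fin m → ℕ) → HasDegree ∣ R ∣ (λ y → prodOver R (λ i → y + c i))
  deg-prodOver []            c y = refl
  deg-prodOver (inside  ∷ R) c = deg-linear ∣ R ∣ (c Fin.zero) (deg-prodOver R (c ∘ Fin.suc))
  deg-prodOver (outside ∷ R) c = deg-prodOver R (c ∘ Fin.suc)

  deg-rootProduct : ∀ R → HasDegree ∣ R ∣ (rootProduct R)
  deg-rootProduct R = deg-prodOver R (λ r → p ∸ toℕ r)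

module Roots (p : ℕ) .{{_ : NonZero p}} (p-prime : Prime p) where
  open Congruence p
  open Degree p

  p∤1 : ¬ p ∣ 1
  p∤1 p∣1 = nonTrivial⇒≢1 {{prime⇒nonTrivial p-prime}} (∣1⇒≡1 p∣1)

  p∣prodOver⇒ : ∀ {m} (R : Subset m) g → p ∣ prodOver R g → ∃ λ i → i ∈ R × p ∣ g i
  p∣prodOver⇒ []            g p∣∏ = ⊥-elim (p∤1 p∣∏)
  p∣prodOver⇒ (inside  ∷ R) g p∣∏ with euclidsLemma (g Fin.zero) _ p-prime p∣∏
  ... | inj₁ p∣g₀ = Fin.zero , here , p∣g₀
  ... | inj₂ p∣∏' with p∣prodOver⇒ R (g ∘ Fin.suc) p∣∏'
  ...   | i , i∈R , p∣gi = Fin.suc i , there i∈R , p∣gi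
  p∣prodOver⇒ (outside ∷ R) g p∣∏ with p∣prodOver⇒ R (g ∘ Fin.suc) p∣∏
  ... | i , i∈R , p∣gi = Fin.suc i , there i∈R , p∣gi

  p∣prodOver⇐ : ∀ {m} (R : Subset m) g i → i ∈ R → p ∣ g i → p ∣ prodOver R g
  p∣prodOver⇐ (inside  ∷ R) g Fin.zero    here        p∣gi = ∣-trans p∣gi (m∣m*n _)
  p∣prodOver⇐ (inside  ∷ R) g (Fin.suc i) (there i∈R) p∣gi =
    ∣-trans (p∣prodOver⇐ R (g ∘ Fin.suc) i i∈R p∣gi) (n∣m*n (g Fin.zero))
  p∣prodOver⇐ (outside ∷ R) g (Fin.suc i) (there i∈R) p∣gi = p∣prodOver⇐ R (g ∘ Fin.suc) i i∈R p∣gi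

  p∣rootProduct⇔ : ∀ R y → p ∣ rootProduct R y ⇔ y mod p ∈ R
  p∣rootProduct⇔ R y = mk⇔ ⇒ ⇐
    where
    ⇒ : p ∣ rootProduct R y → y mod p ∈ R
    ⇒ p∣∏ with p∣prodOver⇒ R (shift y) p∣∏
    ... | r , r∈R , p∣y-r = subst (_∈ R) (sym (to (p∣shift⇔ y r) p∣y-r)) r∈R

    ⇐ : y mod p ∈ R → p ∣ rootProduct R y
    ⇐ y∈R = p∣prodOver⇐ R (shift y) (y mod p) y∈R (from (p∣shift⇔ y (y mod p)) refl)

  -- ∏_{r ∉ R} (y - r) has degree ≤ p - 1; when R is empty it vanishes
  -- identically modulo p and so has degree 0.
  deg-rootProduct-∁ : ∀ R → HasDegree (p ∸ 1) (rootProduct (∁ R))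
  deg-rootProduct-∁ R with ∣ R ∣ in ∣R∣≡
  ... | zero = deg-≤ {zero} {p ∸ 1} z≤n (λ y → trans (vanishes y) (sym (vanishes 0)))
    where
    ∁R≡⊤ : ∁ R ≡ ⊤
    ∁R≡⊤ = ∣p∣≡n⇒p≡⊤ (trans (∣∁p∣≡n∸∣p∣ R) (cong (p ∸_) ∣R∣≡))
    vanishes : ∀ y → rootProduct (∁ R) y ≈ 0
    vanishes y = ∣⇒≈0 (from (p∣rootProduct⇔ (∁ R) y) (subst (y mod p ∈_) (sym ∁R≡⊤) ∈⊤))
  ... | suc _ = deg-≤ ∣∁R∣≤p-1 (deg-rootProduct (∁ R))
    where
    ∣∁R∣≤p-1 : ∣ ∁ R ∣ ≤ p ∸ 1
    ∣∁R∣≤p-1 = subst (_≤ p ∸ 1) (sym (trans (∣∁p∣≡n∸∣p∣ R) (cong (p ∸_) ∣R∣≡))) (∸-monoʳ-≤ p (s≤s z≤n))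

partialBinom : ℕ → (ℕ → ℕ) → ℕ → ℕ
partialBinom m f n = sum (map (m C_) (applyUpTo f n))

partialBinom-pascal : ∀ m f n →
  partialBinom (suc m) (suc ∘ f) n ≡ partialBinom m f n + partialBinom m (suc ∘ f) n
partialBinom-pascal m f zero    = refl
partialBinom-pascal m f (suc n) =
  trans (cong₂ _+_ (sym (nCk+nC[k+1]≡[n+1]C[k+1] m (f 0))) (partialBinom-pascal m (f ∘ suc) n))
        (interchange (m C f 0) (m C suc (f 0)) _ _)
  where
  interchange : ∀ a b c d → a + b + (c + d) ≡ a + c + (b + d)
  interchange = solve-∀

partialBinom-empty : ∀ f n → partialBinom 0 (suc ∘ f) n ≡ 0
partialBinom-empty f zero    = refl
partialBinom-empty f (suc n) = partialBinom-empty (f ∘ suc) n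

binomSum-empty : ∀ s → binomSum 0 s ≡ 1
binomSum-empty s = cong suc (partialBinom-empty (λ t → t) s)

binomSum-pascal : ∀ m s → binomSum (suc m) (suc s) ≡ binomSum m (suc s) + binomSum m s
binomSum-pascal m s =
  trans (cong suc (partialBinom-pascal m (λ t → t) (suc s)))
        (cong suc (+-comm (binomSum m s) (partialBinom m suc (suc s))))

-- The number of subsets of U with at most s elements, via Pascal's recursion on U.
dim : ∀ {k} → Subset k → ℕ → ℕ
dim []            s       = 1
dim (outside ∷ U) s       = dim U s
dim (inside  ∷ U) zero    = dim U zero
dim (inside  ∷ U) (suc s) = dim U (suc s) + dim U s

dim-binomSum : ∀ {k} (U : Subset k) s → dim U s ≡ binomSum ∣ U ∣ s
dim-binomSum []            s       = sym (binomSum-empty s)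
dim-binomSum (outside ∷ U) s       = dim-binomSum U s
dim-binomSum (inside  ∷ U) zero    = dim-binomSum U zero
dim-binomSum (inside  ∷ U) (suc s) =
  trans (cong₂ _+_ (dim-binomSum U (suc s)) (dim-binomSum U s)) (sym (binomSum-pascal ∣ U ∣ s))

module FactorisationLemma (p : ℕ) .{{_ : NonZero p}} where
  open Congruence p
  open Degree p

  record Factorisation {k} (U : Subset k) (s : ℕ) (F : ℕ → ℕ) : Set where
    field
      left right : Subset k → Fin (dim U s) → ℕ
      factors    : ∀ {α β} → α ⊆ U → β ⊆ U → F ∣ α ∩ β ∣ ≈ dot (left α) (right β)

  gate : ∀ {D} → Bool → (Fin D → ℕ) → Fin D → ℕ
  gate true  f = f
  gate false f = λ _ → 0

  dot-gate : ∀ {D} a b (f g : Fin D → ℕ) → dot (gate a f) (gate b g) ≡ (if a ∧ b then dot f g else 0)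
  dot-gate     true  true  f g = refl
  dot-gate {D} true  false f g = sumFin-zero D (λ d → *-zeroʳ (f d))
  dot-gate {D} false b     f g = sumFin-zero D (λ _ → refl)

  ⊆-outside : ∀ {k a} {α U : Subset k} → a ∷ α ⊆ outside ∷ U → a ≡ outside
  ⊆-outside {a = outside} _ = refl
  ⊆-outside {a = inside}  aα⊆U with aα⊆U here
  ... | ()

  -- Induction on U: an element outside U is irrelevant; an element inside U
  -- contributes F(y+1) = F(y) + ΔF(y) when it lies in both α and β.
  factorise : ∀ {k} (U : Subset k) s F → HasDegree s F → Factorisation U s F
  factorise [] s F _ = record
    { left = λ _ _ → F 0 ; right = λ _ _ → 1
    ; factors = λ { {[]} {[]} _ _ → ≡⇒≈ (sym (trans (+-identityʳ _) (*-identityʳ (F 0)))) } }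
  factorise (outside ∷ U) s F deg = record
    { left = left ∘ tail ; right = right ∘ tail ; factors = factors′ }
    where
    open Factorisation (factorise U s F deg)
    factors′ : ∀ {α β} → α ⊆ outside ∷ U → β ⊆ outside ∷ U →
               F ∣ α ∩ β ∣ ≈ dot (left (tail α)) (right (tail β))
    factors′ {a ∷ α} {b ∷ β} aα⊆ bβ⊆ with ⊆-outside aα⊆
    ... | refl = factors (drop-∷-⊆ aα⊆) (drop-∷-⊆ bβ⊆)
  factorise (inside ∷ U) zero F deg = record
    { left = left ∘ tail ; right = right ∘ tail ; factors = factors′ }
    where
    open Factorisation (factorise U zero F deg)
    factors′ : ∀ {α β} → α ⊆ inside ∷ U → β ⊆ inside ∷ U →
               F ∣ α ∩ β ∣ ≈ dot (left (tail α)) (right (tail β))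
    factors′ {a ∷ α} {b ∷ β} aα⊆ bβ⊆ =
      trans (deg _) (trans (sym (deg ∣ α ∩ β ∣)) (factors (drop-∷-⊆ aα⊆) (drop-∷-⊆ bβ⊆)))
  factorise (inside ∷ U) (suc s) F deg = record
    { left    = λ α → left₀ (tail α) ++ gate (head α) (left₁ (tail α))
    ; right   = λ β → right₀ (tail β) ++ gate (head β) (right₁ (tail β))
    ; factors = factors′ }
    where
    open Factorisation (factorise U (suc s) F deg) renaming (left to left₀; right to right₀; factors to factors₀)
    open Factorisation (factorise U s (Δ F) deg) renaming (left to left₁; right to right₁; factors to factors₁)
    factors′ : ∀ {α β} → α ⊆ inside ∷ U → β ⊆ inside ∷ U →
               F ∣ α ∩ β ∣ ≈ dot (left₀ (tail α) ++ gate (head α) (left₁ (tail α)))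
                                 (right₀ (tail β) ++ gate (head β) (right₁ (tail β)))
    factors′ {a ∷ α} {b ∷ β} aα⊆ bβ⊆ =
      trans (first-element (a ∧ b))
            (≡⇒≈ (sym (trans (dot-++ (left₀ α) (right₀ β) _ _)
                             (cong (dot (left₀ α) (right₀ β) +_) (dot-gate a b (left₁ α) (right₁ β))))))
      where
      α⊆U = drop-∷-⊆ aα⊆
      β⊆U = drop-∷-⊆ bβ⊆
      first-element : ∀ c → F ∣ c ∷ (α ∩ β) ∣ ≈
                            dot (left₀ α) (right₀ β) + (if c then dot (left₁ α) (right₁ β) else 0)
      first-element true  = trans (Δ-step F _) (+-≈ (factors₀ α⊆U β⊆U) (factors₁ α⊆U β⊆U))
      first-element false = trans (factors₀ α⊆U β⊆U) (≡⇒≈ (sym (+-identityʳ _)))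

module LinearAlgebra (p : ℕ) .{{_ : NonZero p}} (p-prime : Prime p) where
  open Congruence p
  open Roots p p-prime using (p∤1)

  record Dependence {D k} (v : Fin k → Fin D → ℕ) : Set where
    field
      coeff      : Fin k → ℕ
      pivot      : Fin k
      nontrivial : ¬ p ∣ coeff pivot
      vanishes   : ∀ i → p ∣ sumFin k (λ j → coeff j * v j i)

  extend-first : ∀ {D k} (v : Fin k → Fin (suc D) → ℕ) → (∀ j → p ∣ v j Fin.zero) →
                 Dependence (λ j i → v j (Fin.suc i)) → Dependence v
  extend-first {k = k} v p∣first dep = record
    { coeff = coeff ; pivot = pivot ; nontrivial = nontrivial ; vanishes = vanishes′ }
    where
    open Dependence dep
    vanishes′ : ∀ i → p ∣ sumFin k (λ j → coeff j * v j i)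
    vanishes′ Fin.zero    = sumFin-∣ k (λ j → ∣-trans (p∣first j) (n∣m*n (coeff j)))
    vanishes′ (Fin.suc i) = vanishes i

  -- Elimination against the vector v m: w_j = c·v_{π j} - v_{π j}(0)·v_m where
  -- c = v_m(0) and π = punchIn m; every w_j has first coordinate 0.
  eliminate : ∀ {D k} → (Fin (suc k) → Fin (suc D) → ℕ) → Fin (suc k) → Fin k → Fin (suc D) → ℕ
  eliminate v m j i = v m Fin.zero * v (punchIn m j) i + (p ∸ 1) * (v (punchIn m j) Fin.zero * v m i)

  eliminate-first : ∀ {D k} v m j → p ∣ eliminate {D} {k} v m j Fin.zero
  eliminate-first v m j =
    ≈0⇒∣ (trans (≡⇒≈ (cong (λ z → c * x + (p ∸ 1) * z) (*-comm x c))) (minus-one (c * x)))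
    where
    c = v m Fin.zero
    x = v (punchIn m j) Fin.zero

  -- A relation Σ_j b_j w_j ≡ 0 among the eliminated vectors is the relation
  -- among the v's with coefficient b_j·c at π j and -Σ_j b_j v_{π j}(0) at m.
  back-substitute : ∀ {D k} v m → ¬ p ∣ v m Fin.zero →
                    Dependence (eliminate {D} {k} v m) → Dependence v
  back-substitute {D} {k} v m p∤c dep = record
    { coeff = a ; pivot = punchIn m pivot ; nontrivial = nontrivial′ ; vanishes = vanishes′ }
    where
    open Dependence dep renaming (coeff to b)
    c = v m Fin.zero
    q = p ∸ 1
    π = punchIn m
    S = sumFin k (λ j → b j * v (π j) Fin.zero)

    a : Fin (suc k) → ℕ
    a = insertAt (λ j → b j * c) m (q * S)

    nontrivial′ : ¬ p ∣ a (π pivot)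
    nontrivial′ p∣a with euclidsLemma (b pivot) c p-prime (subst (p ∣_) (insertAt-punchIn _ m _ pivot) p∣a)
    ... | inj₁ p∣b = nontrivial p∣b
    ... | inj₂ p∣c = p∤c p∣c

    same-combination : ∀ i → sumFin (suc k) (λ x → a x * v x i) ≡ sumFin k (λ j → b j * eliminate v m j i)
    same-combination i = begin
      sumFin (suc k) (λ x → a x * v x i)
        ≡⟨ sumFin-insertAt k (λ j → b j * c) m (q * S) (λ x → v x i) ⟩
      q * S * v m i + T
        ≡⟨ commute q S (v m i) T ⟩
      T + q * v m i * S
        ≡⟨ cong (T +_) (sumFin-scale k (q * v m i) _) ⟩
      T + sumFin k (λ j → q * v m i * (b j * v (π j) Fin.zero))
        ≡⟨ sumFin-+ k _ _ ⟨
      sumFin k (λ j → b j * c * v (π j) i + q * v m i * (b j * v (π j) Fin.zero))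
        ≡⟨ sumFin-cong k (λ j → distribute (b j) c (v (π j) i) q (v m i) (v (π j) Fin.zero)) ⟩
      sumFin k (λ j → b j * eliminate v m j i) ∎
      where
      open ≡-Reasoning
      T = sumFin k (λ j → b j * c * v (π j) i)
      commute : ∀ q S z T → q * S * z + T ≡ T + q * z * S
      commute = solve-∀
      distribute : ∀ b c x q z y → b * c * x + q * z * (b * y) ≡ b * (c * x + q * (y * z))
      distribute = solve-∀

    vanishes′ : ∀ i → p ∣ sumFin (suc k) (λ x → a x * v x i)
    vanishes′ i = subst (p ∣_) (sym (same-combination i)) (vanishes i)

  dependence : ∀ D k → D < k → (v : Fin k → Fin D → ℕ) → Dependence v
  dependence zero (suc k) _ v = record
    { coeff = λ _ → 1 ; pivot = Fin.zero ; nontrivial = p∤1 ; vanishes = λ () }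
  dependence (suc D) (suc k) (s≤s D<k) v with any? (λ m → ¬? (p ∣? v m Fin.zero))
  ... | yes (m , p∤vm) =
    back-substitute v m p∤vm (extend-first (eliminate v m) (eliminate-first v m) (dependence D k D<k _))
  ... | no ∄m = extend-first v (λ j → decidable-stable (p ∣? v j Fin.zero) (λ p∤vj → ∄m (j , p∤vj)))
                               (dependence D (suc k) (m<n⇒m<1+n D<k) _)

  independent-bound : ∀ {n} (M : Mat p n) D (φ ψ : Fin n → Fin D → ℕ) →
    (∀ u v → toℕ (M u v) ≈ dot (φ u) (ψ v)) → ∀ k cols → IndependentCols p M cols → k ≤ D
  independent-bound M D φ ψ M≈φψ k cols indep with k ≤? D
  ... | yes k≤D = k≤D
  ... | no k≰D = ⊥-elim (nontrivial (m%n≡0⇒n∣m _ p (trans (sym (toℕ-mod _)) (indep a relation pivot))))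
    where
    open Dependence (dependence D k (≰⇒> k≰D) (ψ ∘ cols))
    a : Fin k → Fin p
    a j = coeff j mod p
    relation : ∀ i → sumFin k (λ j → toℕ (a j) * toℕ (M i (cols j))) % p ≡ 0
    relation i = trans (begin
      sumFin k (λ j → toℕ (a j) * toℕ (M i (cols j))) % p
        ≡⟨ sumFin-≈ k (λ j → *-≈ (trans (≡⇒≈ (toℕ-mod _)) (%-≈ (coeff j))) (M≈φψ i (cols j))) ⟩
      sumFin k (λ j → coeff j * dot (φ i) (ψ (cols j))) % p
        ≡⟨ ≡⇒≈ (sumFin-dot k coeff (φ i) (ψ ∘ cols)) ⟩
      dot (φ i) (λ d → sumFin k (λ j → coeff j * ψ (cols j) d)) % p
        ≡⟨ ∣⇒≈0 (sumFin-∣ D (λ d → ∣-trans (vanishes d) (n∣m*n (φ i d)))) ⟩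
      0 % p ∎) 0%p
      where open ≡-Reasoning

  Extensional : ∀ {k m} → ((Fin k → Fin m) → Set) → Set
  Extensional P = ∀ {f g} → f ≗ g → P f → P g

  all-functions? : ∀ {k m} {P : (Fin k → Fin m) → Set} →
                   Extensional P → (∀ f → Dec (P f)) → Dec (∀ f → P f)
  all-functions? {k} {m} ext P? =
    map′ (λ all f → ext (finToFun-funToFin f) (all (funToFin f))) (λ all i → all (finToFun i))
         (all? (P? ∘ finToFun {m} {k}))

  some-function? : ∀ {k m} {P : (Fin k → Fin m) → Set} →
                   Extensional P → (∀ f → Dec (P f)) → Dec (Σ (Fin k → Fin m) P)
  some-function? {k} {m} ext P? =
    map′ (λ { (i , Pi) → finToFun i , Pi }) (λ { (f , Pf) → funToFin f , ext (sym ∘ finToFun-funToFin f) Pf })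
         (any? (P? ∘ finToFun {m} {k}))

  module _ {n} (M : Mat p n) where

    Relation : ∀ {k} → (Fin k → Fin n) → (Fin k → Fin p) → Set
    Relation {k} cols a = ∀ i → sumFin k (λ j → toℕ (a j) * toℕ (M i (cols j))) % p ≡ 0

    independent? : ∀ {k} (cols : Fin k → Fin n) → Dec (IndependentCols p M cols)
    independent? {k} cols =
      all-functions? respects (λ a → all? (λ i → _ ≟ 0) →-dec all? (λ j → toℕ (a j) ≟ 0))
      where
      respects : Extensional (λ a → Relation cols a → ∀ j → toℕ (a j) ≡ 0)
      respects a≗b trivial rel j = trans (cong toℕ (sym (a≗b j)))
        (trivial (λ i → trans (cong (_% p) (sumFin-cong k (λ j → cong (λ t → toℕ t * _) (a≗b j)))) (rel i)) j)

    independent-respects : ∀ {k} → Extensional {k} (IndependentCols p M)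
    independent-respects {k} c≗d indep a rel = indep a (λ i →
      trans (cong (_% p) (sumFin-cong k (λ j → cong (λ t → toℕ (a j) * toℕ (M i t)) (c≗d j)))) (rel i))

    rank-exists : ∀ D → (∀ k cols → IndependentCols p M cols → k ≤ D) → ∃ (HasRank p M)
    rank-exists D bound with some-function? independent-respects independent?
    ... | yes family = D , family , bound
    rank-exists zero    bound | no none = ⊥-elim (none ((λ ()) , (λ a rel ())))
    rank-exists (suc D) bound | no none = rank-exists D bound′
      where
      bound′ : ∀ k cols → IndependentCols p M cols → k ≤ D
      bound′ k cols indep with k ≟ suc D
      ... | yes refl = ⊥-elim (none (cols , indep))
      ... | no k≢1+D = s≤s⁻¹ (≤∧≢⇒< (bound k cols indep) k≢1+D)

  minRank-bound : ∀ {n} (H : Graph n) (M : Mat p n) D (φ ψ : Fin n → Fin D → ℕ) →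
    Symmetric p M → GraphOf≡ p M H → (∀ u v → toℕ (M u v) ≈ dot (φ u) (ψ v)) →
    ∀ k → IsMinRank p H k → k ≤ D
  minRank-bound H M D φ ψ symmetric has-pattern M≈φψ k (_ , minimal)
    with rank-exists M D (independent-bound M D φ ψ M≈φψ)
  ... | r , rank@((cols , indep) , _) =
    ≤-trans (minimal M symmetric has-pattern r rank) (independent-bound M D φ ψ M≈φψ r cols indep)

module IntersectionMatrices (p : ℕ) .{{_ : NonZero p}} (p-prime : Prime p) {n : ℕ} where
  open Congruence p
  open Degree p
  open FactorisationLemma p
  open LinearAlgebra p p-prime using (minRank-bound)

  intersectionMatrix : ∀ {k} → (ℕ → ℕ) → (Fin n → Subset k) → Mat p n
  intersectionMatrix F A u v = F ∣ A u ∩ A v ∣ mod p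

  intersection-pattern : ∀ {k} (A : Fin n → Subset k) F (H : Graph n) →
    (∀ u v → u ≢ v → Edge H u v ⇔ (¬ p ∣ (F ∣ A u ∩ A v ∣))) → GraphOf≡ p (intersectionMatrix F A) H
  intersection-pattern A F H edge⇔ u v u≢v = ⇔-trans (edge⇔ u v u≢v) (¬-cong-⇔ (p∣⇔residue≡0 _))

  intersection-minRank : ∀ {k} (A : Fin n → Subset k) s F → HasDegree s F → (H : Graph n) →
    GraphOf≡ p (intersectionMatrix F A) H → ∀ m → IsMinRank p H m → m ≤ binomSum (unionSize A) s
  intersection-minRank A s F deg H has-pattern m minRank =
    subst (m ≤_) (dim-binomSum U s)
      (minRank-bound H (intersectionMatrix F A) (dim U s) (left ∘ A) (right ∘ A)
                     symmetric has-pattern factors′ m minRank)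
    where
    U = ⋃ (map A (allFin n))
    open Factorisation (factorise U s F deg)

    symmetric : Symmetric p (intersectionMatrix F A)
    symmetric u v = cong (λ γ → F ∣ γ ∣ mod p) (∩-comm (A u) (A v))

    A⊆U : ∀ u → A u ⊆ U
    A⊆U u = ⊆-⋃ (∈-map⁺ A (∈-allFin u))

    factors′ : ∀ u v → toℕ (intersectionMatrix F A u v) ≈ dot (left (A u)) (right (A v))
    factors′ u v = trans (≡⇒≈ (toℕ-mod _)) (trans (%-≈ _) (factors (A⊆U u) (A⊆U v)))

complement-edge : ∀ {n} (G : Graph n) u v → u ≢ v → Edge (complement G) u v ⇔ (¬ Edge G u v)
complement-edge G u v u≢v with u ≟ᶠ v
... | yes u≡v = ⊥-elim (u≢v u≡v)
... | no  _   = not≡true⇔ (adj G u v)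
  where
  not≡true⇔ : ∀ b → not b ≡ true ⇔ (¬ b ≡ true)
  not≡true⇔ true  = mk⇔ (λ ()) (λ ¬true → ⊥-elim (¬true refl))
  not≡true⇔ false = mk⇔ (λ _ ()) (λ _ → refl)

∈⇔∉∁ : ∀ {m} {x : Fin m} (R : Subset m) → x ∈ R ⇔ (¬ x ∈ ∁ R)
∈⇔∉∁ R = mk⇔ x∈p⇒x∉∁p x∉∁p⇒x∈p

module MinRankBounds (p : ℕ) .{{_ : NonZero p}} (p-prime : Prime p) (R : Subset p)
                     {n} (G : Graph n) {k} (A : Fin n → Subset k) (rep : IsLRep (InL p R) G A) where
  open Degree p
  open Congruence p
  open Roots p p-prime
  open IntersectionMatrices p p-prime

  edge⇔root : ∀ u v → u ≢ v → Edge G u v ⇔ p ∣ (rootProduct R ∣ A u ∩ A v ∣)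
  edge⇔root u v u≢v = ⇔-trans (rep u v u≢v) (⇔-sym (p∣rootProduct⇔ R _))

  complement-bound : ∀ m → IsMinRank p (complement G) m → m ≤ binomSum (unionSize A) ∣ R ∣
  complement-bound = intersection-minRank A ∣ R ∣ (rootProduct R) (deg-rootProduct R) (complement G)
    (intersection-pattern A (rootProduct R) (complement G)
      (λ u v u≢v → ⇔-trans (complement-edge G u v u≢v) (¬-cong-⇔ (edge⇔root u v u≢v))))

  graph-bound : ∀ m → IsMinRank p G m → m ≤ binomSum (unionSize A) (p ∸ 1)
  graph-bound = intersection-minRank A (p ∸ 1) (rootProduct (∁ R)) (deg-rootProduct-∁ R) G
    (intersection-pattern A (rootProduct (∁ R)) G
      (λ u v u≢v → ⇔-trans (rep u v u≢v)
                     (⇔-trans (∈⇔∉∁ R) (¬-cong-⇔ (⇔-sym (p∣rootProduct⇔ (∁ R) _))))))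

theorem3p1 : (p : ℕ) .{{_ : NonZero p}} → Prime p → (R : Subset p) →
    ∀ {n} (G : Graph n) (θ : ℕ) → IsTheta (InL p R) G θ →
    (∀ k → IsMinRank p (complement G) k → k ≤ binomSum θ ∣ R ∣) ×
    (∀ k → IsMinRank p G k → k ≤ binomSum θ (p ∸ 1))
theorem3p1 p p-prime R G θ ((_ , A , rep , ∣⋃A∣≡θ) , _) rewrite sym ∣⋃A∣≡θ =
  complement-bound , graph-bound
  where open MinRankBounds p p-prime R G A rep
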